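{- Let $G$ be a graph with no $K_{1,1,3}$ minor and let $S$ be a spanning subgraph of $G$ that is a subdivision of $K_{2,3}$. Then at most one of the three terminal paths of $S$ is a middle path among the set of terminal paths of $S$.
   Context: A subdivision of a graph is obtained by repeatedly replacing an edge by a path of length 2 through a new vertex. For a subdivision $S$ of $K_{2,3}$, the terminal vertices are the two vertices $u,v$ of degree $3$ in $S$ and the terminal paths are the three $uv$-paths of $S$; $S$ is spanning if it contains all vertices of $G$. An inner vertex of a $uv$-path is a vertex other than $u,v$. Given a set $\mathcal{P}$ of paths in $G$, a path $P\in\mathcal{P}$ is a middle path if for every other path $P'\in\mathcal{P}$ there is an edge of $G$ joining an inner vertex of $P$ to an inner vertex of $P'$. -}

module Defs where

open import Data.Nat using (ℕ; _<_)
open import Data.Fin using (Fin; toℕ)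
open import Data.Maybe using (Maybe; just)
open import Data.List using (List; []; _∷_; _++_; [_])
open import Data.List.Membership.Propositional using (_∈_; _∉_)
open import Data.List.Relation.Unary.Unique.Propositional using (Unique)
open import Data.List.Relation.Unary.Linked using (Linked)
open import Data.Product using (Σ; ∃; ∃-syntax; _×_)
open import Data.Sum using (_⊎_)
open import Relation.Nullary using (¬_)
open import Relation.Binary.PropositionalEquality using (_≡_; _≢_)
open import Relation.Binary.Construct.Closure.ReflexiveTransitive using (Star)

record SimpleGraph (n : ℕ) : Set₁ where
  field
    Adj   : Fin n → Fin n → Set
    sym   : ∀ {x y} → Adj x y → Adj y x
    irrefl : ∀ {x} → ¬ Adj x x
open SimpleGraph public

-- H (a graph on Fin k given by its adjacency relation) is a minor of G:
-- a partial map f assigns vertices of G to branch sets (vertices mapped to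
-- nothing are deleted); branch sets are automatically disjoint, must be
-- nonempty and connected in G, and adjacent vertices of H have branch sets
-- joined by an edge of G.
record MinorModel {n : ℕ} (G : SimpleGraph n) (k : ℕ) (HAdj : Fin k → Fin k → Set) : Set where
  field
    branch    : Fin n → Maybe (Fin k)
    nonempty  : ∀ i → ∃[ x ] branch x ≡ just i
    connected : ∀ i x y → branch x ≡ just i → branch y ≡ just i →
                Star (λ a b → Adj G a b × branch a ≡ just i × branch b ≡ just i) x y
    edges     : ∀ i j → HAdj i j →
                ∃[ x ] ∃[ y ] (branch x ≡ just i × branch y ≡ just j × Adj G x y)

HasMinor : {n : ℕ} → SimpleGraph n → (k : ℕ) → (Fin k → Fin k → Set) → Set
HasMinor G k HAdj = MinorModel G k HAdj

-- K_{1,1,3} on Fin 5: vertices 0,1 are adjacent to everything else,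
-- vertices 2,3,4 are pairwise nonadjacent.
K113Adj : Fin 5 → Fin 5 → Set
K113Adj i j = i ≢ j × (toℕ i < 2 ⊎ toℕ j < 2)

-- A spanning subgraph of G that is a subdivision of K_{2,3}, given by its
-- terminal vertices u, v and the lists of inner vertices of the three
-- terminal paths (path i is  u ∷ inner i ++ [ v ]).
record SpanningK23Subdivision {n : ℕ} (G : SimpleGraph n) : Set where
  field
    u v        : Fin n
    inner      : Fin 3 → List (Fin n)
    u≢v        : u ≢ v
    nonempty   : ∀ i → inner i ≢ []
    isPath     : ∀ i → Linked (Adj G) (u ∷ inner i ++ [ v ])
    innerUniq  : ∀ i → Unique (inner i)
    u∉inner    : ∀ i → u ∉ inner i
    v∉inner    : ∀ i → v ∉ inner i
    disjoint   : ∀ i j → i ≢ j → ∀ x → x ∈ inner i → x ∉ inner j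
    spanning   : ∀ x → x ≡ u ⊎ x ≡ v ⊎ ∃[ i ] x ∈ inner i
open SpanningK23Subdivision public

MiddlePath : {n : ℕ} {G : SimpleGraph n} → SpanningK23Subdivision G → Fin 3 → Set
MiddlePath {G = G} S i = ∀ j → j ≢ i →
  ∃[ x ] ∃[ y ] (x ∈ inner S i × y ∈ inner S j × Adj G x y)

-- If two terminal paths P_i, P_j were both middle paths, contract the inner
-- vertices of P_i, of P_j and of the third path P_c to single vertices. The
-- contracted P_i and P_j are adjacent to each other, to P_c (being middle),
-- and to u and v (as their ends), while u, v and P_c form the independent
-- side: a K_{1,1,3} minor.

module Submission where

open import Defs
open import Data.Nat using (ℕ; _<_; s≤s)
open import Data.Fin using (Fin; zero; suc; toℕ; _≟_)
open import Data.Fin.Properties using (any?)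
open import Data.Maybe using (Maybe; just; nothing)
open import Data.List using (List; []; _∷_; _++_; [_])
open import Data.List.Membership.Propositional using (_∈_)
import Data.List.Membership.DecPropositional as DecMembership
open import Data.List.Relation.Unary.All using (All; _∷_; tabulate)
open import Data.List.Relation.Unary.Any using (here; there)
open import Data.List.Relation.Unary.Linked as Linked using (Linked; [-]; _∷_)
open import Data.Product using (∃-syntax; _×_; _,_)
open import Data.Sum using (inj₁; inj₂)
open import Data.Empty using (⊥-elim)
open import Relation.Nullary using (¬_; Dec; yes; no)
open import Relation.Binary.PropositionalEquality as ≡
  using (_≡_; _≢_; refl; cong; module ≡-Reasoning)
open import Relation.Binary.Construct.Closure.ReflexiveTransitive using (Star; ε; _◅_; _◅◅_)

module _ {A : Set} {R : A → A → Set} where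

  Linked-++⁻ˡ : ∀ xs {ys} → Linked R (xs ++ ys) → Linked R xs
  Linked-++⁻ˡ []           _         = Linked.[]
  Linked-++⁻ˡ (x ∷ [])     _         = [-]
  Linked-++⁻ˡ (x ∷ y ∷ xs) (r ∷ rs) = r ∷ Linked-++⁻ˡ (y ∷ xs) rs

  Linked-last : ∀ xs {v} → xs ≢ [] → Linked R (xs ++ [ v ]) → ∃[ x ] (x ∈ xs × R x v)
  Linked-last []           xs≢[] _        = ⊥-elim (xs≢[] refl)
  Linked-last (x ∷ [])     _     (r ∷ _)  = x , here refl , r
  Linked-last (x ∷ y ∷ xs) _     (_ ∷ rs) with Linked-last (y ∷ xs) (λ ()) rs
  ... | z , z∈ , r = z , there z∈ , r

  Linked-first : ∀ u xs {v} → xs ≢ [] → Linked R (u ∷ xs ++ [ v ]) → ∃[ x ] (x ∈ xs × R u x)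
  Linked-first u []       xs≢[] _       = ⊥-elim (xs≢[] refl)
  Linked-first u (x ∷ xs) _     (r ∷ _) = x , here refl , r

  Linked-connected : (∀ {a b} → R a b → R b a) → {Q : A → Set} → ∀ {xs x y} →
    Linked R xs → All Q xs → x ∈ xs → y ∈ xs → Star (λ a b → R a b × Q a × Q b) x y
  Linked-connected R-sym [-] (q ∷ _) (here refl) (here refl) = ε
  Linked-connected R-sym (r ∷ rs) (q ∷ qs@(q′ ∷ _)) x∈ y∈ with x∈ | y∈
  ... | here refl  | here refl  = ε
  ... | here refl  | there y∈′ = (r , q , q′) ◅ Linked-connected R-sym rs qs (here refl) y∈′
  ... | there x∈′ | here refl  =
    Linked-connected R-sym rs qs x∈′ (here refl) ◅◅ ((R-sym r , q′ , q) ◅ ε)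
  ... | there x∈′ | there y∈′ = Linked-connected R-sym rs qs x∈′ y∈′

Touch : {n : ℕ} → SimpleGraph n → List (Fin n) → List (Fin n) → Set
Touch G xs ys = ∃[ x ] ∃[ y ] (x ∈ xs × y ∈ ys × Adj G x y)

Touch-sym : ∀ {n} (G : SimpleGraph n) {xs ys} → Touch G xs ys → Touch G ys xs
Touch-sym G (x , y , x∈ , y∈ , xy) = y , x , y∈ , x∈ , SimpleGraph.sym G xy

PartsDisjoint : {I A : Set} → (I → List A) → Set
PartsDisjoint part = ∀ {x a b} → x ∈ part a → x ∈ part b → a ≡ b

module _ {n k : ℕ} (part : Fin k → List (Fin n)) where

  open DecMembership (_≟_ {n}) using (_∈?_)

  inSomePart? : ∀ x → Dec (∃[ a ] x ∈ part a)
  inSomePart? x = any? (λ a → x ∈? part a)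

  branchOf : Fin n → Maybe (Fin k)
  branchOf x with inSomePart? x
  ... | yes (a , _) = just a
  ... | no _        = nothing

  branchOf-sound : ∀ {x a} → branchOf x ≡ just a → x ∈ part a
  branchOf-sound {x} eq with inSomePart? x | eq
  ... | yes (a , x∈a) | refl = x∈a

  branchOf-complete : PartsDisjoint part → ∀ {x a} → x ∈ part a → branchOf x ≡ just a
  branchOf-complete disjoint {x} {a} x∈a with inSomePart? x
  ... | yes (b , x∈b) = cong just (disjoint x∈b x∈a)
  ... | no ∄          = ⊥-elim (∄ (a , x∈a))

  minorFromParts : (G : SimpleGraph n) (H : Fin k → Fin k → Set) → PartsDisjoint part →
    (∀ a → ∃[ x ] x ∈ part a) → (∀ a → Linked (Adj G) (part a)) →
    (∀ a b → H a b → Touch G (part a) (part b)) → HasMinor G k H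
  minorFromParts G H disjoint inhabited linked touch = record
    { branch    = branchOf
    ; nonempty  = λ a → let x , x∈ = inhabited a in x , complete x∈
    ; connected = λ a x y bx by →
        Linked-connected (SimpleGraph.sym G) (linked a) (tabulate complete)
          (branchOf-sound bx) (branchOf-sound by)
    ; edges     = λ a b hab → let x , y , x∈ , y∈ , xy = touch a b hab in
        x , y , complete x∈ , complete y∈ , xy
    }
    where
    complete : ∀ {x a} → x ∈ part a → branchOf x ≡ just a
    complete = branchOf-complete disjoint

data Piece : Set where
  innerOf   : Fin 3 → Piece
  terminalU : Piece
  terminalV : Piece

innerOf-injective : ∀ {s t} → innerOf s ≡ innerOf t → s ≡ t
innerOf-injective refl = refl

module Pieces {n : ℕ} {G : SimpleGraph n} (S : SpanningK23Subdivision G) where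

  piece : Piece → List (Fin n)
  piece (innerOf t) = inner S t
  piece terminalU   = [ u S ]
  piece terminalV   = [ v S ]

  piece-disjoint : PartsDisjoint piece
  piece-disjoint {_} {innerOf s} {innerOf t} x∈s x∈t with s ≟ t
  ... | yes s≡t = cong innerOf s≡t
  ... | no s≢t  = ⊥-elim (disjoint S s t s≢t _ x∈s x∈t)
  piece-disjoint {_} {innerOf s} {terminalU} x∈s (here refl) = ⊥-elim (u∉inner S s x∈s)
  piece-disjoint {_} {innerOf s} {terminalV} x∈s (here refl) = ⊥-elim (v∉inner S s x∈s)
  piece-disjoint {_} {terminalU} {innerOf t} (here refl) x∈t = ⊥-elim (u∉inner S t x∈t)
  piece-disjoint {_} {terminalV} {innerOf t} (here refl) x∈t = ⊥-elim (v∉inner S t x∈t)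
  piece-disjoint {_} {terminalU} {terminalU} _ _ = refl
  piece-disjoint {_} {terminalV} {terminalV} _ _ = refl
  piece-disjoint {_} {terminalU} {terminalV} (here refl) (here u≡v) = ⊥-elim (u≢v S u≡v)
  piece-disjoint {_} {terminalV} {terminalU} (here refl) (here v≡u) = ⊥-elim (u≢v S (≡.sym v≡u))

  piece-inhabited : ∀ p → ∃[ x ] x ∈ piece p
  piece-inhabited (innerOf t) with Linked-first (u S) (inner S t) (nonempty S t) (isPath S t)
  ... | x , x∈ , _ = x , x∈
  piece-inhabited terminalU = u S , here refl
  piece-inhabited terminalV = v S , here refl

  piece-linked : ∀ p → Linked (Adj G) (piece p)
  piece-linked (innerOf t) = Linked-++⁻ˡ (inner S t) (Linked.tail (isPath S t))
  piece-linked terminalU   = [-]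
  piece-linked terminalV   = [-]

  middle-touches : ∀ {t} → MiddlePath S t → ∀ p → p ≢ innerOf t → Touch G (inner S t) (piece p)
  middle-touches middle (innerOf s) s≢t = middle s (λ s≡t → s≢t (cong innerOf s≡t))
  middle-touches {t} _ terminalU _ with Linked-first (u S) (inner S t) (nonempty S t) (isPath S t)
  ... | x , x∈ , ux = x , u S , x∈ , here refl , SimpleGraph.sym G ux
  middle-touches {t} _ terminalV _
    with Linked-last (inner S t) (nonempty S t) (Linked.tail (isPath S t))
  ... | x , x∈ , xv = x , v S , x∈ , here refl , xv

module Contraction {n : ℕ} {G : SimpleGraph n} (S : SpanningK23Subdivision G)
  (i j c : Fin 3) (i≢j : i ≢ j) (c≢i : c ≢ i) (c≢j : c ≢ j)
  (middle-i : MiddlePath S i) (middle-j : MiddlePath S j) where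

  open Pieces S

  branchPiece : Fin 5 → Piece
  branchPiece zero                         = innerOf i
  branchPiece (suc zero)                   = innerOf j
  branchPiece (suc (suc zero))             = terminalU
  branchPiece (suc (suc (suc zero)))       = terminalV
  branchPiece (suc (suc (suc (suc zero)))) = innerOf c

  branchIndex : Piece → Fin 5
  branchIndex (innerOf t) with t ≟ i | t ≟ j
  ... | yes _ | _     = zero
  ... | no _  | yes _ = suc zero
  ... | no _  | no _  = suc (suc (suc (suc zero)))
  branchIndex terminalU = suc (suc zero)
  branchIndex terminalV = suc (suc (suc zero))

  branchIndex-branchPiece : ∀ a → branchIndex (branchPiece a) ≡ a
  branchIndex-branchPiece zero with i ≟ i
  ... | yes _   = refl
  ... | no i≢i  = ⊥-elim (i≢i refl)
  branchIndex-branchPiece (suc zero) with j ≟ i | j ≟ j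
  ... | yes j≡i | _       = ⊥-elim (i≢j (≡.sym j≡i))
  ... | no _    | yes _   = refl
  ... | no _    | no j≢j  = ⊥-elim (j≢j refl)
  branchIndex-branchPiece (suc (suc zero))       = refl
  branchIndex-branchPiece (suc (suc (suc zero))) = refl
  branchIndex-branchPiece (suc (suc (suc (suc zero)))) with c ≟ i | c ≟ j
  ... | yes c≡i | _       = ⊥-elim (c≢i c≡i)
  ... | no _    | yes c≡j = ⊥-elim (c≢j c≡j)
  ... | no _    | no _    = refl

  branchPiece-injective : ∀ {a b} → branchPiece a ≡ branchPiece b → a ≡ b
  branchPiece-injective {a} {b} eq = begin
    a                           ≡⟨ ≡.sym (branchIndex-branchPiece a) ⟩
    branchIndex (branchPiece a) ≡⟨ cong branchIndex eq ⟩
    branchIndex (branchPiece b) ≡⟨ branchIndex-branchPiece b ⟩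
    b                           ∎
    where open ≡-Reasoning

  part : Fin 5 → List (Fin n)
  part a = piece (branchPiece a)

  centre-touches : ∀ a b → toℕ a < 2 → a ≢ b → Touch G (part a) (part b)
  centre-touches zero       b _ a≢b =
    middle-touches middle-i (branchPiece b) (λ eq → a≢b (≡.sym (branchPiece-injective eq)))
  centre-touches (suc zero) b _ a≢b =
    middle-touches middle-j (branchPiece b) (λ eq → a≢b (≡.sym (branchPiece-injective eq)))
  centre-touches (suc (suc _)) _ (s≤s (s≤s ())) _

  k113-touches : ∀ a b → K113Adj a b → Touch G (part a) (part b)
  k113-touches a b (a≢b , inj₁ a<2) = centre-touches a b a<2 a≢b
  k113-touches a b (a≢b , inj₂ b<2) =
    Touch-sym G (centre-touches b a b<2 (λ b≡a → a≢b (≡.sym b≡a)))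

  k113-minor : HasMinor G 5 K113Adj
  k113-minor = minorFromParts part G K113Adj
    (λ x∈a x∈b → branchPiece-injective (piece-disjoint x∈a x∈b))
    (λ a → piece-inhabited (branchPiece a))
    (λ a → piece-linked (branchPiece a))
    k113-touches

third : (i j : Fin 3) → i ≢ j → ∃[ c ] (c ≢ i × c ≢ j)
third zero             zero             i≢j = ⊥-elim (i≢j refl)
third zero             (suc zero)       _   = suc (suc zero) , (λ ()) , (λ ())
third zero             (suc (suc zero)) _   = suc zero , (λ ()) , (λ ())
third (suc zero)       zero             _   = suc (suc zero) , (λ ()) , (λ ())
third (suc zero)       (suc zero)       i≢j = ⊥-elim (i≢j refl)
third (suc zero)       (suc (suc zero)) _   = zero , (λ ()) , (λ ())
third (suc (suc zero)) zero             _   = suc zero , (λ ()) , (λ ())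
third (suc (suc zero)) (suc zero)       _   = zero , (λ ()) , (λ ())
third (suc (suc zero)) (suc (suc zero)) i≢j = ⊥-elim (i≢j refl)

lemma6 : (n : ℕ) (G : SimpleGraph n) → ¬ HasMinor G 5 K113Adj →
    (S : SpanningK23Subdivision G) → (i j : Fin 3) →
    MiddlePath S i → MiddlePath S j → i ≡ j
lemma6 n G noMinor S i j middle-i middle-j with i ≟ j
... | yes i≡j = i≡j
... | no i≢j with third i j i≢j
... | c , c≢i , c≢j =
  ⊥-elim (noMinor (Contraction.k113-minor S i j c i≢j c≢i c≢j middle-i middle-j))
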